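{- Let $m\ge1$, $n_1,\dots,n_m$ positive integers, $N_i=n_1+\dots+n_i$, and for a sequence $\mathbf k=(k_1,\dots,k_m)$ put $\mathbf k^*=(N_1-k_1+1,\,N_2-k_2+1,\dots,N_m-k_m+1)$. (i) If $k_1<k_2<\dots<k_m$ are positive integers with $k_1\le n_1$, $k_i<k_{i-1}+n_i$ for $1<i<m$, and $k_m\le k_{m-1}+n_m$, then $H_\exists(\mathbf n,\mathbf k)^*=H_\forall(\mathbf n,\mathbf k^*)$. (ii) If $k_1<\dots<k_{m-1}\le k_m$ are positive integers with $k_1\le n_1$ and $k_i<k_{i-1}+n_i$ for $1<i\le m$, then $H_\forall(\mathbf n,\mathbf k)^*=H_\exists(\mathbf n,\mathbf k^*)$.
   Context: Submultisets of $\{1^{n_1},\dots,m^{n_m}\}$ are written $\{1^{\ell_1},\dots,m^{\ell_m}\}$ with $0\le\ell_i\le n_i$; the complement of such a submultiset is $\{1^{n_1-\ell_1},\dots,m^{n_m-\ell_m}\}$. A simple game on the multiset is a nonempty family of winning submultisets closed under taking larger submultisets (componentwise). $H_\exists(\mathbf n,\mathbf k)$ is the game in which $\{1^{\ell_1},\dots,m^{\ell_m}\}$ is winning iff there exists $i$ with $\ell_1+\dots+\ell_i\ge k_i$; $H_\forall(\mathbf n,\mathbf k)$ is the game in which it is winning iff $\ell_1+\dots+\ell_i\ge k_i$ for all $i$. The dual $G^*$ of a game $G$ on the multiset is the game whose winning submultisets are exactly the complements of the losing submultisets of $G$. -}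

module Defs where

open import Data.Nat using (ℕ; zero; suc; _+_; _∸_; _≤_; _<_)
open import Data.Fin using (Fin; zero; suc; toℕ)
open import Data.Product using (Σ; ∃; _×_)
open import Relation.Nullary using (¬_)
open import Function using (_∘_)
open import Function.Bundles using (_⇔_)

-- A (sub)multiset of {1^{n_1},...,m^{n_m}} is encoded by its multiplicity
-- vector ℓ : Fin m → ℕ (index i : Fin m stands for element i+1).
Mult : ℕ → Set
Mult m = Fin m → ℕ

IsSub : ∀ {m} → Mult m → Mult m → Set
IsSub n ℓ = ∀ i → ℓ i ≤ n i

compl : ∀ {m} → Mult m → Mult m → Mult m
compl n ℓ i = n i ∸ ℓ i

psum : ∀ {m} → (Fin m → ℕ) → Fin m → ℕ
psum f zero    = f zero
psum f (suc i) = f zero + psum (f ∘ suc) i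

-- A game is given by its predicate "is winning" on multiplicity vectors
-- (only its values on submultisets of n matter).
Game : ℕ → Set₁
Game m = Mult m → Set

HExists : ∀ {m} → Mult m → (Fin m → ℕ) → Game m
HExists n k ℓ = ∃ λ i → k i ≤ psum ℓ i

HForall : ∀ {m} → Mult m → (Fin m → ℕ) → Game m
HForall n k ℓ = ∀ i → k i ≤ psum ℓ i

Dual : ∀ {m} → Mult m → Game m → Game m
Dual n G ℓ = ¬ G (compl n ℓ)

_≐[_]_ : ∀ {m} → Game m → Mult m → Game m → Set
G ≐[ n ] H = ∀ ℓ → IsSub n ℓ → (G ℓ ⇔ H ℓ)

kstar : ∀ {m} → Mult m → (Fin m → ℕ) → Fin m → ℕ
kstar n k i = suc (psum n i ∸ k i)

Next : ∀ {m} → Fin m → Fin m → Set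
Next i j = toℕ j ≡ suc (toℕ i)
  where open import Relation.Binary.PropositionalEquality using (_≡_)

-- A submultiset ℓ and its complement have prefix sums adding up to N_i, so the
-- complement misses the i-th threshold k_i exactly when ℓ_1 + ... + ℓ_i exceeds
-- N_i − k_i, i.e. reaches k*_i.  Complementation thus turns "some threshold is
-- met" into "no dual threshold is missed" and conversely, by the same
-- pointwise equivalence.  The only property of k this needs is k_i ≤ N_i
-- (so that N_i − k_i is not truncated), which the hypotheses on k provide.
module Submission where

open import Defs
open import Data.Nat using (ℕ; suc; _+_; _∸_; _≤_; _<_; _≤?_)
open import Data.Nat.Properties
open import Data.Fin using (Fin; toℕ; zero; suc)
open import Data.Fin.Properties using (¬∀⟶∃¬; toℕ<n)
open import Data.Product using (_×_; _,_)
open import Data.Sum using (inj₁; inj₂)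
open import Relation.Nullary using (¬_)
open import Function using (_∘_)
open import Function.Bundles using (_⇔_; mk⇔; Equivalence)
open import Algebra.Properties.CommutativeSemigroup +-commutativeSemigroup using (interchange)
open import Relation.Binary.PropositionalEquality
  using (_≡_; refl; sym; trans; cong; cong₂; subst; module ≡-Reasoning)

<⇔∸< : ∀ {C L N k} → C + L ≡ N → k ≤ N → C < k ⇔ N ∸ k < L
<⇔∸< {C} {L} {N} {k} C+L≡N k≤N = mk⇔ to from
  where
  k+suc[N∸k]≡suc[N] : k + suc (N ∸ k) ≡ suc N
  k+suc[N∸k]≡suc[N] = trans (+-suc k (N ∸ k)) (cong suc (m+[n∸m]≡n k≤N))

  to : C < k → N ∸ k < L
  to C<k = +-cancelˡ-≤ k _ _
    (subst (_≤ k + L) (trans (cong suc C+L≡N) (sym k+suc[N∸k]≡suc[N])) (+-monoˡ-< L C<k))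

  from : N ∸ k < L → C < k
  from N∸k<L = +-cancelʳ-< L C k
    (subst (_≤ k + L) (trans k+suc[N∸k]≡suc[N] (cong suc (sym C+L≡N))) (+-monoʳ-≤ k N∸k<L))

psum-compl-+ : ∀ {m} (n ℓ : Mult m) → IsSub n ℓ →
  ∀ i → psum (compl n ℓ) i + psum ℓ i ≡ psum n i
psum-compl-+ n ℓ ℓ⊆n zero = m∸n+n≡m (ℓ⊆n zero)
psum-compl-+ n ℓ ℓ⊆n (suc i) = begin
  (n zero ∸ ℓ zero + psum (compl n ℓ ∘ suc) i) + (ℓ zero + psum (ℓ ∘ suc) i)
    ≡⟨ interchange (n zero ∸ ℓ zero) _ (ℓ zero) _ ⟩
  (n zero ∸ ℓ zero + ℓ zero) + (psum (compl n ℓ ∘ suc) i + psum (ℓ ∘ suc) i)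
    ≡⟨ cong₂ _+_ (m∸n+n≡m (ℓ⊆n zero)) (psum-compl-+ (n ∘ suc) (ℓ ∘ suc) (ℓ⊆n ∘ suc) i) ⟩
  n zero + psum (n ∘ suc) i ∎
  where open ≡-Reasoning

compl-misses⇔kstar-reached : ∀ {m} (n ℓ k : Mult m) → IsSub n ℓ → ∀ i → k i ≤ psum n i →
  (¬ k i ≤ psum (compl n ℓ) i) ⇔ kstar n k i ≤ psum ℓ i
compl-misses⇔kstar-reached n ℓ k ℓ⊆n i k≤N = mk⇔
  (to ∘ ≰⇒>) (λ reached → <⇒≱ (from reached))
  where open Equivalence (<⇔∸< {psum (compl n ℓ) i} {psum ℓ i} (psum-compl-+ n ℓ ℓ⊆n i) k≤N)

Dual-HExists : ∀ {m} (n k : Mult m) → (∀ i → k i ≤ psum n i) →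
  Dual n (HExists n k) ≐[ n ] HForall n (kstar n k)
Dual-HExists n k k≤N ℓ ℓ⊆n = mk⇔
  (λ lose i → to (i-th i) (λ hit → lose (i , hit)))
  (λ win (i , hit) → from (i-th i) (win i) hit)
  where
  open Equivalence
  i-th : ∀ i → (¬ k i ≤ psum (compl n ℓ) i) ⇔ kstar n k i ≤ psum ℓ i
  i-th i = compl-misses⇔kstar-reached n ℓ k ℓ⊆n i (k≤N i)

Dual-HForall : ∀ {m} (n k : Mult m) → (∀ i → k i ≤ psum n i) →
  Dual n (HForall n k) ≐[ n ] HExists n (kstar n k)
Dual-HForall {m} n k k≤N ℓ ℓ⊆n = mk⇔
  (λ lose → let (i , miss) = ¬∀⟶∃¬ m _ (λ i → k i ≤? psum (compl n ℓ) i) lose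
            in i , to (i-th i) miss)
  (λ (i , reached) win → from (i-th i) reached (win i))
  where
  open Equivalence
  i-th : ∀ i → (¬ k i ≤ psum (compl n ℓ) i) ⇔ kstar n k i ≤ psum ℓ i
  i-th i = compl-misses⇔kstar-reached n ℓ k ℓ⊆n i (k≤N i)

≤-+-psum : ∀ {m} (n k : Fin (suc m) → ℕ) c → k zero ≤ c + n zero →
  (∀ i j → Next i j → k j ≤ k i + n j) → ∀ i → k i ≤ c + psum n i
≤-+-psum n k c k₁≤c+n₁ step zero = k₁≤c+n₁
≤-+-psum {suc m} n k c k₁≤c+n₁ step (suc i) =
  subst (k (suc i) ≤_) (+-assoc c (n zero) (psum (n ∘ suc) i))
    (≤-+-psum (n ∘ suc) (k ∘ suc) (c + n zero) k₂≤c+n₁+n₂ (λ i j → step (suc i) (suc j) ∘ cong suc) i)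
  where
  k₂≤c+n₁+n₂ : k (suc zero) ≤ (c + n zero) + n (suc zero)
  k₂≤c+n₁+n₂ = ≤-trans (step zero (suc zero) refl) (+-monoˡ-≤ (n (suc zero)) k₁≤c+n₁)

≤-psum : ∀ {m} (n k : Fin m → ℕ) → (∀ i → toℕ i ≡ 0 → k i ≤ n i) →
  (∀ i j → Next i j → k j ≤ k i + n j) → ∀ i → k i ≤ psum n i
≤-psum {suc m} n k k₁≤n₁ step = ≤-+-psum n k 0 (k₁≤n₁ zero refl) step

theorem4 : (m : ℕ) → 1 ≤ m → (n : Fin m → ℕ) → (∀ i → 0 < n i) → (k : Fin m → ℕ) →
    ((∀ i → 0 < k i) →
     (∀ i j → Next i j → k i < k j) →
     (∀ i → toℕ i ≡ 0 → k i ≤ n i) →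
     (∀ i j → Next i j → suc (toℕ j) < m → k j < k i + n j) →
     (∀ i j → Next i j → suc (toℕ j) ≡ m → k j ≤ k i + n j) →
     Dual n (HExists n k) ≐[ n ] HForall n (kstar n k))
    ×
    ((∀ i → 0 < k i) →
     (∀ i j → Next i j → suc (toℕ j) < m → k i < k j) →
     (∀ i j → Next i j → suc (toℕ j) ≡ m → k i ≤ k j) →
     (∀ i → toℕ i ≡ 0 → k i ≤ n i) →
     (∀ i j → Next i j → k j < k i + n j) →
     Dual n (HForall n k) ≐[ n ] HExists n (kstar n k))
theorem4 m _ n _ k =
  (λ _ _ k₁≤n₁ inner-step last-step →
     Dual-HExists n k (≤-psum n k k₁≤n₁ (step inner-step last-step)))
  ,
  (λ _ _ _ k₁≤n₁ strict-step →
     Dual-HForall n k (≤-psum n k k₁≤n₁ (λ i j i→j → <⇒≤ (strict-step i j i→j))))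
  where
  step : (∀ i j → Next i j → suc (toℕ j) < m → k j < k i + n j) →
         (∀ i j → Next i j → suc (toℕ j) ≡ m → k j ≤ k i + n j) →
         ∀ i j → Next i j → k j ≤ k i + n j
  step inner last i j i→j with m≤n⇒m<n∨m≡n (toℕ<n j)
  ... | inj₁ j-inner = <⇒≤ (inner i j i→j j-inner)
  ... | inj₂ j-last  = last i j i→j j-last
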